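{- Let $S=(1,2,2,2,2,2)$ and $n=25m$ with $m$ a positive integer. Then $\chi_S(C_n(2,3))=6$.
   Context: For integers $n$ and $s_1,\ldots,s_k$, the circulant graph $C_n(s_1,\ldots,s_k)$ has vertex set $\{0,1,\ldots,n-1\}$, and each vertex $i$ is adjacent to $i+s_j \pmod n$ (and hence to $i-s_j\pmod n$) for every $j$. For a graph $G$ and a non-decreasing sequence $S=(a_1,a_2,\ldots)$ of positive integers, an $S$-packing $k$-coloring of $G$ is a map $f:V(G)\to\{1,\ldots,k\}$ (with $k$ at most the length of $S$ when $S$ is finite) such that any two distinct vertices $u,v$ with $f(u)=f(v)=i$ satisfy $d_G(u,v)>a_i$, where $d_G$ is the shortest-path distance; $\chi_S(G)$ is the smallest such $k$. -}

module Defs where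

open import Data.Nat using (ℕ; zero; suc; _≤_; _*_)
open import Data.Fin using (Fin; toℕ; inject≤)
open import Data.Integer using (ℤ; +_; _-_; _+_)
open import Data.Integer.Divisibility using (_∣_)
open import Data.List using (List)
open import Data.List.Relation.Unary.Any using (Any)
open import Data.Vec using (Vec; lookup)
open import Data.Product using (Σ; _×_; ∃-syntax)
open import Data.Sum using (_⊎_)
open import Relation.Nullary using (¬_)
open import Relation.Binary.PropositionalEquality using (_≡_)

record Graph : Set₁ where
  field
    N   : ℕ
    Adj : Fin N → Fin N → Set
open Graph public

-- Circulant graph C_n(s_1,…,s_k): vertices 0..n-1, i adjacent to i ± s_j (mod n).
Circulant : (n : ℕ) → List ℕ → Graph
Circulant n ss = record
  { N   = n
  ; Adj = λ i j → Any (λ s → ((+ n) ∣ ((+ toℕ j) - ((+ toℕ i) + (+ s))))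
                           ⊎ ((+ n) ∣ ((+ toℕ j) - ((+ toℕ i) - (+ s))))) ss
  }

data Walk (G : Graph) : Fin (N G) → Fin (N G) → ℕ → Set where
  nil  : ∀ {u} → Walk G u u 0
  cons : ∀ {u w v k} → Adj G u w → Walk G w v k → Walk G u v (suc k)

-- d_G(u,v) ≤ a  (there is a walk, hence a path, of length at most a)
DistLe : (G : Graph) → Fin (N G) → Fin (N G) → ℕ → Set
DistLe G u v a = ∃[ k ] (k ≤ a × Walk G u v k)

DistGt : (G : Graph) → Fin (N G) → Fin (N G) → ℕ → Set
DistGt G u v a = ¬ DistLe G u v a

-- An S-packing k-colouring of G, for a finite sequence S of length L (k ≤ L).
-- Colour c ∈ Fin k corresponds to the (c+1)-st colour and uses distance bound a_{c+1}.
PackingColoring : (G : Graph) → {L : ℕ} → Vec ℕ L → ℕ → Set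
PackingColoring G {L} S k =
  Σ (k ≤ L) λ k≤L →
  Σ (Fin (N G) → Fin k) λ f →
  ∀ u v → ¬ (u ≡ v) → f u ≡ f v → DistGt G u v (lookup S (inject≤ (f u) k≤L))

PackingChromaticIs : (G : Graph) → {L : ℕ} → Vec ℕ L → ℕ → Set
PackingChromaticIs G S k =
  PackingColoring G S k × (∀ k′ → PackingColoring G S k′ → k ≤ k′)

-- Upper bound: since 25 ∣ n, colouring u by a fixed pattern of u mod 25 is well defined around
-- the cycle. Two distinct vertices at distance at most 2 are congruent to each other plus a
-- nonzero offset of absolute value at most 6, so it suffices to check the pattern on residues.
-- Lower bound: on the vertices 0, …, 9 (n ≥ 10), the colour of packing distance 1 may not recur
-- at gap 2 or 3 (these vertices are adjacent), and a colour of packing distance 2 may not recur at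
-- any gap from 1 to 6 (gap 1 is the walk +3, −2). An exhaustive search shows that no sequence of
-- ten colours from five satisfies these constraints.

module Submission where

open import Defs
open import Data.Nat using (ℕ; _*_; _<_)
open import Data.List using (_∷_; [])
open import Data.Vec using (_∷_; [])

open import Data.Nat using (zero; suc; _≤_; _≤ᵇ_; _≡ᵇ_; NonZero; s≤s; z≤n; _≤?_)
import Data.Nat as ℕ
import Data.Nat.Properties as ℕ
import Data.Nat.Divisibility as ℕ
open import Data.Nat.DivMod using (_%_; _/_; _mod_; m≡m%n+[m/n]*n; m<n⇒m%n≡m)
open import Data.Integer using (ℤ; +_; -[1+_]; -_; 0ℤ; ∣_∣; _+_; _-_)
open import Data.Integer.Properties
  using (∣-i∣≡∣i∣; ∣i∣≡0⇒i≡0; ∣i+j∣≤∣i∣+∣j∣; ∣m⊝n∣≤m⊔n; m-n≡m⊖n; pos-+; +-inverseʳ; i-j≡0⇒i≡j; +-injective)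
open import Data.Integer.Divisibility.Signed
  using (_∣_; _∣?_; ∣ᵤ⇒∣; ∣⇒∣ᵤ; ∣-trans; ∣m∣n⇒∣m+n; ∣m∣n⇒∣m-n; ∣m⇒∣-m)
open import Data.Integer.Tactic.RingSolver using (solve-∀)
open import Data.Fin using (Fin; toℕ; inject≤; fromℕ<; #_) renaming (zero to fzero; suc to fsuc)
import Data.Fin as Fin
open import Data.Fin.Properties using (toℕ-fromℕ<; toℕ-inject≤; toℕ-injective; toℕ<n; all?)
open import Data.Bool using (Bool; true; false; T; not; _∧_; _∨_)
open import Data.Bool.Properties using (T-∧; T?)
open import Data.List using (List; upTo)
open import Data.Bool.ListAction using (all)
open import Data.List.Membership.Propositional using (_∈_; find; lose)
open import Data.List.Membership.Propositional.Properties using (∈-upTo⁺)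
open import Data.List.Relation.Unary.Any using (here; there)
import Data.List.Relation.Unary.All as All
open import Data.List.Relation.Unary.All.Properties using (all⁺)
open import Data.Vec using (Vec; lookup)
open import Data.Product using (_,_; _×_; proj₂; ∃-syntax)
open import Data.Sum using (_⊎_; inj₁; inj₂)
open import Data.Empty using (⊥; ⊥-elim)
open import Data.Unit using (tt)
open import Function using (Equivalence; _∘_)
open import Relation.Nullary using (¬_; Dec; yes; no; map′)
open import Relation.Nullary.Decidable using (toWitness; _→-dec_; ¬?)
open import Relation.Binary.PropositionalEquality

record Offset (n x y : ℕ) (δ : ℤ) : Set where
  constructor offset
  field divides : + n ∣ + y - (+ x + δ)

module _ {n : ℕ} where

  ≡⇒offset : ∀ {x y δ} → + y ≡ + x + δ → Offset n x y δ
  ≡⇒offset {x} {y} {δ} y≡x+δ = offset (subst (+ n ∣_) (sym (begin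
    + y - (+ x + δ)           ≡⟨ cong (_- (+ x + δ)) y≡x+δ ⟩
    (+ x + δ) - (+ x + δ)     ≡⟨ +-inverseʳ (+ x + δ) ⟩
    0ℤ                        ∎)) (∣ᵤ⇒∣ {+ n} {0ℤ} (n ℕ.∣0)))
    where open ≡-Reasoning

  offset-sym : ∀ {x y δ} → Offset n x y δ → Offset n y x (- δ)
  offset-sym {x} {y} {δ} (offset p) = offset (subst (+ n ∣_) (negate (+ x) (+ y) δ) (∣m⇒∣-m p))
    where
    negate : ∀ a b d → - (b - (a + d)) ≡ a - (b + - d)
    negate = solve-∀

  offset-trans : ∀ {x y z δ ε} → Offset n x y δ → Offset n y z ε → Offset n x z (δ + ε)
  offset-trans {x} {y} {z} {δ} {ε} (offset p) (offset q) =
    offset (subst (+ n ∣_) (split (+ x) (+ y) (+ z) δ ε) (∣m∣n⇒∣m+n q p))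
    where
    split : ∀ a b c d e → (c - (b + e)) + (b - (a + d)) ≡ c - (a + (d + e))
    split = solve-∀

  offset-abs : ∀ {x y δ} → Offset n x y δ → Offset n x y (+ ∣ δ ∣) ⊎ Offset n y x (+ ∣ δ ∣)
  offset-abs {δ = + d}      p = inj₁ p
  offset-abs {δ = -[1+ d ]} p = inj₂ (offset-sym p)

  offset-multiples : ∀ x y q r {δ} → Offset n (x ℕ.+ q ℕ.* n) (y ℕ.+ r ℕ.* n) δ → Offset n x y δ
  offset-multiples x y q r {δ} (offset p) =
    offset (subst (+ n ∣_) eq (∣m∣n⇒∣m+n (∣m∣n⇒∣m-n p (n∣ r)) (n∣ q)))
    where
    n∣ : ∀ k → + n ∣ + (k ℕ.* n)
    n∣ k = ∣ᵤ⇒∣ {+ n} {+ (k ℕ.* n)} (ℕ.n∣m*n k)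
    shift : ∀ a b Q R d → ((b + R) - ((a + Q) + d) - R) + Q ≡ b - (a + d)
    shift = solve-∀
    eq : (+ (y ℕ.+ r ℕ.* n) - (+ (x ℕ.+ q ℕ.* n) + δ) - + (r ℕ.* n)) + + (q ℕ.* n)
       ≡ + y - (+ x + δ)
    eq rewrite pos-+ y (r ℕ.* n) | pos-+ x (q ℕ.* n) =
      shift (+ x) (+ y) (+ (q ℕ.* n)) (+ (r ℕ.* n)) δ

  offset-mod : ∀ .{{_ : NonZero n}} {x y δ} → Offset n x y δ →
               Offset n (toℕ (x mod n)) (toℕ (y mod n)) δ
  offset-mod {x} {y} {δ} p = subst₂ (λ a b → Offset n a b δ) (sym (toℕ-fromℕ< _)) (sym (toℕ-fromℕ< _))
    (offset-multiples (x % n) (y % n) (x / n) (y / n)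
      (subst₂ (λ a b → Offset n a b δ) (m≡m%n+[m/n]*n x n) (m≡m%n+[m/n]*n y n) p))

  offset-divisor : ∀ {m x y δ} → m ℕ.∣ n → Offset n x y δ → Offset m x y δ
  offset-divisor {m} m∣n (offset p) = offset (∣-trans (∣ᵤ⇒∣ {+ m} {+ n} m∣n) p)

  offset? : ∀ x y δ → Dec (Offset n x y δ)
  offset? x y δ = map′ offset Offset.divides (+ n ∣? (+ y - (+ x + δ)))

  offset-zero⇒≡ : ∀ .{{_ : NonZero n}} {x y} → x ℕ.< n → y ℕ.< n → Offset n x y 0ℤ → x ≡ y
  offset-zero⇒≡ {x} {y} x<n y<n (offset p) =
    sym (+-injective (i-j≡0⇒i≡j (+ y) (+ x) (∣i∣≡0⇒i≡0 ∣y-x∣≡0)))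
    where
    ∣y-x∣<n : ∣ + y - + x ∣ ℕ.< n
    ∣y-x∣<n = subst (ℕ._< n) (cong ∣_∣ (sym (m-n≡m⊖n y x)))
                    (ℕ.≤-<-trans (∣m⊝n∣≤m⊔n y x) (ℕ.⊔-lub y<n x<n))
    ∣y-x∣≡0 : ∣ + y - + x ∣ ≡ 0
    ∣y-x∣≡0 = trans (sym (m<n⇒m%n≡m ∣y-x∣<n))
                    (ℕ.n∣m⇒m%n≡0 _ n (∣⇒∣ᵤ (subst (λ a → + n ∣ + y - + a) (ℕ.+-identityʳ x) p)))

module _ {n : ℕ} {ss : List ℕ} where

  adj⇒offset : ∀ {u w} → Adj (Circulant n ss) u w →
               ∃[ δ ] ∣ δ ∣ ∈ ss × Offset n (toℕ u) (toℕ w) δ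
  adj⇒offset a with find a
  ... | s , s∈ss , inj₁ p = + s , s∈ss , offset (∣ᵤ⇒∣ p)
  ... | s , s∈ss , inj₂ p = - + s , subst (_∈ ss) (sym (∣-i∣≡∣i∣ (+ s))) s∈ss , offset (∣ᵤ⇒∣ p)

  offset⇒adj : ∀ .{{_ : NonZero n}} {x y δ} → ∣ δ ∣ ∈ ss → Offset n x y δ →
               Adj (Circulant n ss) (x mod n) (y mod n)
  offset⇒adj {δ = + s}      s∈ss p = lose s∈ss (inj₁ (∣⇒∣ᵤ (Offset.divides (offset-mod p))))
  offset⇒adj {δ = -[1+ s ]} s∈ss p = lose s∈ss (inj₂ (∣⇒∣ᵤ (Offset.divides (offset-mod p))))

jumps : List ℕ
jumps = 2 ∷ 3 ∷ []

2∈jumps : 2 ∈ jumps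
2∈jumps = here refl

3∈jumps : 3 ∈ jumps
3∈jumps = there (here refl)

C : ℕ → Graph
C n = Circulant n jumps

S : Vec ℕ 6
S = 1 ∷ 2 ∷ 2 ∷ 2 ∷ 2 ∷ 2 ∷ []

radius : ℕ → ℕ
radius zero    = 1
radius (suc _) = 2

lookup-S : ∀ {k} (c : Fin k) (k≤6 : k ≤ 6) → lookup S (inject≤ c k≤6) ≡ radius (toℕ c)
lookup-S c k≤6 = trans (lookup-S-radius (inject≤ c k≤6)) (cong radius (toℕ-inject≤ c k≤6))
  where
  lookup-S-radius : ∀ j → lookup S j ≡ radius (toℕ j)
  lookup-S-radius fzero                                    = refl
  lookup-S-radius (fsuc fzero)                             = refl
  lookup-S-radius (fsuc (fsuc fzero))                      = refl
  lookup-S-radius (fsuc (fsuc (fsuc fzero)))               = refl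
  lookup-S-radius (fsuc (fsuc (fsuc (fsuc fzero))))        = refl
  lookup-S-radius (fsuc (fsuc (fsuc (fsuc (fsuc fzero))))) = refl

-- The gaps d > 0 along the cycle at which two vertices of colour c are within distance radius c.
forbidden-gap : ℕ → ℕ → Bool
forbidden-gap zero    d = (d ≡ᵇ 2) ∨ (d ≡ᵇ 3)
forbidden-gap (suc _) d = (1 ≤ᵇ d) ∧ (d ≤ᵇ 6)

jump-forbidden : ∀ c {d} → d ∈ jumps → T (forbidden-gap c d)
jump-forbidden zero    (here refl)         = tt
jump-forbidden zero    (there (here refl)) = tt
jump-forbidden (suc _) (here refl)         = tt
jump-forbidden (suc _) (there (here refl)) = tt

jump≤3 : ∀ {d} → d ∈ jumps → d ≤ 3
jump≤3 (here refl)         = ℕ.n≤1+n 2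
jump≤3 (there (here refl)) = ℕ.≤-refl

forbidden-gap-suc : ∀ c {d} → 1 ≤ d → d ≤ 6 → T (forbidden-gap (suc c) d)
forbidden-gap-suc c {d} 1≤d d≤6 = Equivalence.from T-∧ (ℕ.≤⇒≤ᵇ 1≤d , ℕ.≤⇒≤ᵇ d≤6)

forbidden-gap<7 : ∀ c d → T (forbidden-gap c d) → d < 7
forbidden-gap<7 zero    2 _ = s≤s (s≤s (s≤s z≤n))
forbidden-gap<7 zero    3 _ = s≤s (s≤s (s≤s (s≤s z≤n)))
forbidden-gap<7 (suc _) d t = s≤s (ℕ.≤ᵇ⇒≤ d 6 (proj₂ (Equivalence.to T-∧ t)))

module _ {n : ℕ} .{{_ : NonZero n}} where

  close⇒forbidden-offset : ∀ c {u v : Fin n} {k} → u ≢ v → k ≤ radius c → Walk (C n) u v k →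
                           ∃[ δ ] T (forbidden-gap c ∣ δ ∣) × Offset n (toℕ u) (toℕ v) δ
  close⇒forbidden-offset c u≢v _ nil = ⊥-elim (u≢v refl)
  close⇒forbidden-offset c _ _ (cons a nil) with adj⇒offset a
  ... | δ , δ∈ , p = δ , jump-forbidden c δ∈ , p
  close⇒forbidden-offset (suc c) {u} {v} u≢v _ (cons a (cons b nil))
    with adj⇒offset a | adj⇒offset b
  ... | δ , δ∈ , p | ε , ε∈ , q = δ + ε , forbidden-gap-suc c 1≤∣δ+ε∣ ∣δ+ε∣≤6 , offset-trans p q
    where
    ∣δ+ε∣≤6 : ∣ δ + ε ∣ ≤ 6
    ∣δ+ε∣≤6 = ℕ.≤-trans (∣i+j∣≤∣i∣+∣j∣ δ ε) (ℕ.+-mono-≤ (jump≤3 δ∈) (jump≤3 ε∈))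
    ∣δ+ε∣≢0 : ∣ δ + ε ∣ ≢ 0
    ∣δ+ε∣≢0 eq = u≢v (toℕ-injective (offset-zero⇒≡ (toℕ<n u) (toℕ<n v)
                   (subst (Offset n (toℕ u) (toℕ v)) (∣i∣≡0⇒i≡0 eq) (offset-trans p q))))
    1≤∣δ+ε∣ : 1 ≤ ∣ δ + ε ∣
    1≤∣δ+ε∣ = ℕ.n≢0⇒n>0 ∣δ+ε∣≢0
  close⇒forbidden-offset zero    _ (s≤s ())       (cons _ (cons _ _))
  close⇒forbidden-offset (suc c) _ (s≤s (s≤s ())) (cons _ (cons _ (cons _ _)))

  vertex : ℕ → Fin n
  vertex i = i mod n

  vertex-injective : ∀ {i j} → i < n → j < n → vertex i ≡ vertex j → i ≡ j
  vertex-injective {i} {j} i<n j<n eq = begin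
    i                ≡⟨ m<n⇒m%n≡m i<n ⟨
    i % n            ≡⟨ toℕ-fromℕ< _ ⟨
    toℕ (vertex i)   ≡⟨ cong toℕ eq ⟩
    toℕ (vertex j)   ≡⟨ toℕ-fromℕ< _ ⟩
    j % n            ≡⟨ m<n⇒m%n≡m j<n ⟩
    j                ∎
    where open ≡-Reasoning

  jump⁺ : ∀ i {s} → s ∈ jumps → Adj (C n) (vertex i) (vertex (i ℕ.+ s))
  jump⁺ i {s} s∈ = offset⇒adj s∈ (≡⇒offset {δ = + s} refl)

  jump⁻ : ∀ i {s} → s ∈ jumps → Adj (C n) (vertex (i ℕ.+ s)) (vertex i)
  jump⁻ i {s} s∈ =
    offset⇒adj (subst (_∈ jumps) (sym (∣-i∣≡∣i∣ (+ s))) s∈) (offset-sym (≡⇒offset {δ = + s} refl))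

  jump-jump : ∀ i {s t} → s ∈ jumps → t ∈ jumps →
              Walk (C n) (vertex i) (vertex (i ℕ.+ (s ℕ.+ t))) 2
  jump-jump i {s} {t} s∈ t∈ = cons (jump⁺ i s∈) (cons
    (subst (Adj (C n) (vertex (i ℕ.+ s)) ∘ vertex) (ℕ.+-assoc i s t) (jump⁺ (i ℕ.+ s) t∈)) nil)

  one-jump : ∀ c i {s} → s ∈ jumps → DistLe (C n) (vertex i) (vertex (i ℕ.+ s)) (radius c)
  one-jump zero    i s∈ = 1 , ℕ.≤-refl , cons (jump⁺ i s∈) nil
  one-jump (suc _) i s∈ = 1 , s≤s z≤n , cons (jump⁺ i s∈) nil

  forbidden⇒close : ∀ c i d → T (forbidden-gap c d) →
                    DistLe (C n) (vertex i) (vertex (i ℕ.+ d)) (radius c)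
  forbidden⇒close zero    i 2 _ = one-jump zero i 2∈jumps
  forbidden⇒close zero    i 3 _ = one-jump zero i 3∈jumps
  forbidden⇒close (suc c) i 1 _ = 2 , ℕ.≤-refl , cons (jump⁺ i 3∈jumps) (cons back nil)
    where
    back : Adj (C n) (vertex (i ℕ.+ 3)) (vertex (i ℕ.+ 1))
    back = subst (λ j → Adj (C n) (vertex j) (vertex (i ℕ.+ 1))) (ℕ.+-assoc i 1 2)
                 (jump⁻ (i ℕ.+ 1) 2∈jumps)
  forbidden⇒close (suc c) i 2 _ = one-jump (suc c) i 2∈jumps
  forbidden⇒close (suc c) i 3 _ = one-jump (suc c) i 3∈jumps
  forbidden⇒close (suc c) i 4 _ = 2 , ℕ.≤-refl , jump-jump i 2∈jumps 2∈jumps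
  forbidden⇒close (suc c) i 5 _ = 2 , ℕ.≤-refl , jump-jump i 2∈jumps 3∈jumps
  forbidden⇒close (suc c) i 6 _ = 2 , ℕ.≤-refl , jump-jump i 3∈jumps 3∈jumps

GapFree : ℕ → (ℕ → ℕ) → Set
GapFree N c = ∀ i d → i ℕ.+ suc d < N → c i ≡ c (i ℕ.+ suc d) → ¬ T (forbidden-gap (c i) (suc d))

history : (ℕ → ℕ) → ℕ → List ℕ
history c zero    = []
history c (suc i) = c i ∷ history c i

-- fits d xs e: colour e, placed d steps after the head of xs, recurs at no forbidden gap.
fits : ℕ → List ℕ → ℕ → Bool
fits d []       e = true
fits d (x ∷ xs) e = not ((x ≡ᵇ e) ∧ forbidden-gap e d) ∧ fits (suc d) xs e

-- blocked r xs: no r further colours from {0,…,4} continue xs without a forbidden recurrence.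
blocked : ℕ → List ℕ → Bool
dead-end : ℕ → List ℕ → ℕ → Bool

blocked zero    xs = false
blocked (suc r) xs = all (dead-end r xs) (upTo 5)

dead-end r xs e = not (fits 1 xs e) ∨ blocked r (e ∷ xs)

not-both : ∀ {a b} → (T a → T b → ⊥) → T (not (a ∧ b))
not-both {false}         _ = tt
not-both {true} {false} _ = tt
not-both {true} {true}  h = h tt tt

module _ {N : ℕ} {c : ℕ → ℕ} (gap-free : GapFree N c) where

  fits-history : ∀ j d → j ℕ.+ d < N → T (fits (suc d) (history c j) (c (j ℕ.+ d)))
  fits-history zero    d _ = tt
  fits-history (suc j) d j+d<N = Equivalence.from T-∧ (no-recurrence , rest)
    where
    j+1+d<N : j ℕ.+ suc d < N
    j+1+d<N = subst (_< N) (sym (ℕ.+-suc j d)) j+d<N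
    no-recurrence : T (not ((c j ≡ᵇ c (suc j ℕ.+ d)) ∧ forbidden-gap (c (suc j ℕ.+ d)) (suc d)))
    no-recurrence = not-both λ same forbidden →
      let cj≡c[j+1+d] = ℕ.≡ᵇ⇒≡ (c j) (c (suc j ℕ.+ d)) same
      in gap-free j d j+1+d<N (trans cj≡c[j+1+d] (cong c (sym (ℕ.+-suc j d))))
           (subst (λ e → T (forbidden-gap e (suc d))) (sym cj≡c[j+1+d]) forbidden)
    rest : T (fits (suc (suc d)) (history c j) (c (suc j ℕ.+ d)))
    rest = subst (T ∘ fits (suc (suc d)) (history c j) ∘ c) (ℕ.+-suc j d)
                 (fits-history j (suc d) j+1+d<N)

  blocked-unsound : (∀ i → c i < 5) → ∀ r j → j ℕ.+ r ≤ N → ¬ T (blocked r (history c j))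
  blocked-unsound c<5 (suc r) j j+r≤N b =
    blocked-unsound c<5 r (suc j) (subst (_≤ N) (ℕ.+-suc j r) j+r≤N) (or-elim dead-end-j fits-j)
    where
    dead-end-j : T (dead-end r (history c j) (c j))
    dead-end-j = All.lookup (all⁺ (dead-end r (history c j)) (upTo 5) b) (∈-upTo⁺ (c<5 j))
    fits-j : T (fits 1 (history c j) (c j))
    fits-j = subst (T ∘ fits 1 (history c j) ∘ c) (ℕ.+-identityʳ j)
                   (fits-history j 0 (ℕ.≤-trans (ℕ.+-monoʳ-< j (s≤s z≤n)) j+r≤N))
    or-elim : ∀ {a b} → T (not a ∨ b) → T a → T b
    or-elim {true} t _ = t

-- The exhaustive search: blocked 10 [] evaluates to true.
five-colours-not-gap-free : ∀ c → (∀ i → c i < 5) → ¬ GapFree 10 c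
five-colours-not-gap-free c c<5 gap-free = blocked-unsound gap-free c<5 10 0 ℕ.≤-refl tt

module _ {n : ℕ} .{{_ : NonZero n}} where

  packing⇒gap-free : 10 ≤ n → ∀ {k} (k≤6 : k ≤ 6) (f : Fin n → Fin k) →
                     (∀ u v → u ≢ v → f u ≡ f v → DistGt (C n) u v (lookup S (inject≤ (f u) k≤6))) →
                     GapFree 10 (λ i → toℕ (f (vertex i)))
  packing⇒gap-free 10≤n k≤6 f separated i d i+1+d<10 same forbidden =
    separated (vertex i) (vertex (i ℕ.+ suc d)) distinct (toℕ-injective same)
      (subst (DistLe (C n) (vertex i) (vertex (i ℕ.+ suc d))) (sym (lookup-S (f (vertex i)) k≤6))
             (forbidden⇒close _ i (suc d) forbidden))
    where
    i+1+d<n : i ℕ.+ suc d < n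
    i+1+d<n = ℕ.<-≤-trans i+1+d<10 10≤n
    distinct : vertex i ≢ vertex (i ℕ.+ suc d)
    distinct eq = ℕ.<⇒≢ (ℕ.m<m+n i (s≤s z≤n))
      (vertex-injective (ℕ.≤-<-trans (ℕ.m≤m+n i (suc d)) i+1+d<n) i+1+d<n eq)

  packing-lower-bound : 10 ≤ n → ∀ k → PackingColoring (C n) S k → 6 ≤ k
  packing-lower-bound 10≤n k (k≤6 , f , separated) with 6 ≤? k
  ... | yes 6≤k = 6≤k
  ... | no  6≰k = ⊥-elim (five-colours-not-gap-free (λ i → toℕ (f (vertex i))) c<5
                                                   (packing⇒gap-free 10≤n k≤6 f separated))
    where
    c<5 : ∀ i → toℕ (f (vertex i)) < 5
    c<5 i = ℕ.<-≤-trans (toℕ<n (f (vertex i))) (ℕ.≤-pred (ℕ.≰⇒> 6≰k))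

-- Positions 0 and 1 of each block of five get colour 0; the other positions run through the colours
-- 1, …, 5 cyclically, so a colour other than 0 recurs only at gaps of at least 7, also across the
-- end of the period.
period : Fin 25 → Fin 6
period = lookup (# 0 ∷ # 0 ∷ # 1 ∷ # 2 ∷ # 3 ∷ # 0 ∷ # 0 ∷ # 4 ∷ # 5 ∷ # 1 ∷ # 0 ∷ # 0 ∷ # 2 ∷
                  # 3 ∷ # 4 ∷ # 0 ∷ # 0 ∷ # 5 ∷ # 1 ∷ # 2 ∷ # 0 ∷ # 0 ∷ # 3 ∷ # 4 ∷ # 5 ∷ [])

period-gap-free : ∀ (i j : Fin 25) (d : Fin 7) → T (forbidden-gap (toℕ (period i)) (toℕ d)) →
                   Offset 25 (toℕ i) (toℕ j) (+ toℕ d) → period i ≢ period j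
period-gap-free = toWitness {a? = all? λ i → all? λ j → all? λ d →
  T? _ →-dec (offset? (toℕ i) (toℕ j) (+ toℕ d) →-dec ¬? (period i Fin.≟ period j))} _

module _ {n : ℕ} .{{_ : NonZero n}} (25∣n : 25 ℕ.∣ n) where

  periodic : Fin n → Fin 6
  periodic u = period (toℕ u mod 25)

  periodic-separates : ∀ (u v : Fin n) d → T (forbidden-gap (toℕ (periodic u)) d) →
                       Offset n (toℕ u) (toℕ v) (+ d) → periodic u ≢ periodic v
  periodic-separates u v d forbidden p = subst
    (λ e → T (forbidden-gap (toℕ (periodic u)) e) → Offset 25 _ _ (+ e) → periodic u ≢ periodic v)
    (toℕ-fromℕ< d<7)
    (period-gap-free (toℕ u mod 25) (toℕ v mod 25) (fromℕ< d<7))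
    forbidden (offset-mod (offset-divisor 25∣n p))
    where
    d<7 : d < 7
    d<7 = forbidden-gap<7 (toℕ (periodic u)) d forbidden

  periodic-packing : ∀ u v → u ≢ v → periodic u ≡ periodic v →
                     DistGt (C n) u v (lookup S (inject≤ (periodic u) ℕ.≤-refl))
  periodic-packing u v u≢v same (k , k≤ , walk)
    with close⇒forbidden-offset (toℕ (periodic u)) u≢v
           (subst (k ≤_) (lookup-S (periodic u) ℕ.≤-refl) k≤) walk
  ... | δ , forbidden , p with offset-abs p
  ... | inj₁ p⁺ = periodic-separates u v ∣ δ ∣ forbidden p⁺ same
  ... | inj₂ p⁻ = periodic-separates v u ∣ δ ∣
                    (subst (λ e → T (forbidden-gap (toℕ e) ∣ δ ∣)) same forbidden) p⁻ (sym same)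

corollary12 : (m : ℕ) → 0 < m →
    PackingChromaticIs (Circulant (25 * m) (2 ∷ 3 ∷ [])) (1 ∷ 2 ∷ 2 ∷ 2 ∷ 2 ∷ 2 ∷ []) 6
corollary12 m@(suc _) _ =
  (ℕ.≤-refl , periodic 25∣n , periodic-packing 25∣n) , packing-lower-bound 10≤n
  where
  25∣n : 25 ℕ.∣ 25 * m
  25∣n = ℕ.m∣m*n m
  10≤n : 10 ≤ 25 * m
  10≤n = ℕ.≤-trans (ℕ.m≤m+n 10 15) (ℕ.m≤m*n 25 m)
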